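{- Let $q\in\mathbb{C}$ with $|q|<1$, and let $k,l\ge0$ be integers. Then for $x\in[0,1]$, $$B_{k,l}(x,q)=\frac{k!}{[k]_q!}x^k\sum_{m=0}^l\frac{[m]_q!}{m!}S(m,k)\,\beta_{l-m}^{(k)}((1-x)_q,q)\binom{l}{m}_q.$$
   Context: $[x]_q=\frac{1-q^x}{1-q}$, $[n]_q!=[n]_q\cdots[1]_q$, $[0]_q!=1$, $\binom{n}{k}_q=\frac{[n]_q!}{[k]_q![n-k]_q!}$ for $0\le k\le n$. $(1-x)_q^m=\prod_{i=1}^m(1-xq^{i-1})$. $B_{k,n}(x,q)=\binom{n}{k}_qx^k(1-x)_q^{n-k}$ if $n\ge k$ and $0$ if $n<k$. $S(m,k)$ are the Stirling numbers of the second kind: $\frac{(e^t-1)^k}{k!}=\sum_{m\ge0}S(m,k)\frac{t^m}{m!}$. $B_m^{(k)}$ are the Bernoulli numbers of order $k$: $\left(\frac{z}{e^z-1}\right)^k=\sum_{m\ge0}B_m^{(k)}\frac{z^m}{m!}$. The $q$-Bernoulli polynomials of order $k$ are defined by $\left(\frac{z}{e^z-1}\right)^ke_q(zy)=\sum_{n\ge0}\beta_n^{(k)}(y,q)\frac{z^n}{[n]_q!}$ with $e_q(u)=\sum_{j\ge0}\frac{u^j}{[j]_q!}$, so that $\beta_n^{(k)}(y,q)=\sum_{m=0}^n\binom{n}{m}_q\frac{[m]_q!}{m!}y^{n-m}B_m^{(k)}$. The symbol $\beta_n^{(k)}((1-x)_q,q)$ denotes this expression with each power $y^{j}$ replaced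 by $(1-x)_q^{j}$, i.e. $\beta_n^{(k)}((1-x)_q,q)=\sum_{m=0}^n\binom{n}{m}_q\frac{[m]_q!}{m!}(1-x)_q^{n-m}B_m^{(k)}$. -}

module Defs where

open import Level using (Level; _⊔_) renaming (suc to lsuc)
open import Algebra.Bundles using (CommutativeRing)
open import Data.Nat as ℕ using (ℕ; zero; suc; _∸_; _≤?_)
open import Data.Nat.Combinatorics using (_C_)
open import Relation.Nullary using (¬_; yes; no)

record Field (c ℓ : Level) : Set (lsuc (c ⊔ ℓ)) where
  field
    commutativeRing : CommutativeRing c ℓ
  open CommutativeRing commutativeRing public
  field
    inv     : (a : Carrier) → ¬ (a ≈ 0#) → Carrier
    inverse : (a : Carrier) (p : ¬ (a ≈ 0#)) → a * inv a p ≈ 1#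
    0≉1     : ¬ (0# ≈ 1#)

module FieldNotions {c ℓ : Level} (F : Field c ℓ) where
  open Field F

  fromℕ : ℕ → Carrier
  fromℕ zero    = 0#
  fromℕ (suc n) = 1# + fromℕ n

  CharZero : Set ℓ
  CharZero = (n : ℕ) → ¬ (fromℕ (suc n) ≈ 0#)

  pow : Carrier → ℕ → Carrier
  pow a zero    = 1#
  pow a (suc n) = a * pow a n

  sumTo : ℕ → (ℕ → Carrier) → Carrier
  sumTo zero    f = f 0
  sumTo (suc n) f = sumTo n f + f (suc n)

  sumBelow : ℕ → (ℕ → Carrier) → Carrier
  sumBelow zero    f = 0#
  sumBelow (suc n) f = sumBelow n f + f n

  prod1 : ℕ → (ℕ → Carrier) → Carrier
  prod1 zero    f = 1#
  prod1 (suc n) f = prod1 n f * f (suc n)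

  -- [n]_q = 1 + q + ... + q^{n-1}  ( = (1 - q^n)/(1 - q) for q ≠ 1 )
  qint : Carrier → ℕ → Carrier
  qint q n = sumBelow n (pow q)

  qfact : Carrier → ℕ → Carrier
  qfact q n = prod1 n (qint q)

  -- Gaussian binomial coefficient via the q-Pascal rule
  -- (equal to [n]_q!/([k]_q![n-k]_q!) for 0 ≤ k ≤ n, and 0 for k > n)
  qbinom : Carrier → ℕ → ℕ → Carrier
  qbinom q n       zero    = 1#
  qbinom q zero    (suc k) = 0#
  qbinom q (suc n) (suc k) = qbinom q n k + pow q (suc k) * qbinom q n (suc k)

  -- (1 - x)_q^m = Π_{i=1}^{m} (1 - x q^{i-1})
  qshift : Carrier → Carrier → ℕ → Carrier
  qshift x q m = prod1 m (λ i → 1# + - (x * pow q (i ∸ 1)))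

  qBernstein : ℕ → ℕ → Carrier → Carrier → Carrier
  qBernstein k n x q with k ≤? n
  ... | yes _ = qbinom q n k * pow x k * qshift x q (n ∸ k)
  ... | no  _ = 0#

  stirling2 : ℕ → ℕ → ℕ
  stirling2 zero    zero    = 1
  stirling2 zero    (suc k) = 0
  stirling2 (suc m) zero    = 0
  stirling2 (suc m) (suc k) = suc k ℕ.* stirling2 m (suc k) ℕ.+ stirling2 m k

  module WithCharZero (char0 : CharZero) where

    invSuc : ℕ → Carrier
    invSuc n = inv (fromℕ (suc n)) (char0 n)

    invFact : ℕ → Carrier
    invFact n = prod1 n (λ i → invSuc (i ∸ 1))

    -- Bernoulli numbers (z/(e^z-1) convention, B₁ = -1/2), explicit formula
    -- B_m = Σ_{j=0}^{m} 1/(j+1) Σ_{i=0}^{j} (-1)^i C(j,i) i^m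
    bernoulli : ℕ → Carrier
    bernoulli m =
      sumTo m (λ j → invSuc j *
        sumTo j (λ i → pow (- 1#) i * fromℕ (j C i) * fromℕ (i ℕ.^ m)))

    -- Bernoulli numbers of order k: coefficients of (z/(e^z-1))^k,
    -- i.e. k-fold binomial convolution of the B_m
    bernoulliOrd : ℕ → ℕ → Carrier
    bernoulliOrd zero    zero    = 1#
    bernoulliOrd zero    (suc m) = 0#
    bernoulliOrd (suc k) m =
      sumTo m (λ j → fromℕ (m C j) * bernoulli j * bernoulliOrd k (m ∸ j))

    qBernoulliShift : ℕ → ℕ → Carrier → Carrier → Carrier
    qBernoulliShift k n x q =
      sumTo n (λ m → qbinom q n m * (qfact q m * invFact m)
                     * qshift x q (n ∸ m) * bernoulliOrd k m)

{-# OPTIONS --safe #-}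
-- Read a sequence f as the q-exponential generating function Σ f n zⁿ / [n]_q!; products of
-- such series are q-binomial convolutions _⋆_, associative by a q-Leibniz rule.  With
-- a m = [m]_q! / m!, the sum on the right is the l-th coefficient of
-- (a·S(-,k)) ⋆ ((a·B^(k)) ⋆ (1-x)_q^(-)).  Multiplying by a carries ordinary exponential
-- convolution to q-convolution, so the first two factors give a times the coefficients of
-- (eᶻ - 1)ᵏ / k! · (z / (eᶻ - 1))ᵏ = zᵏ / k!, i.e. a k at index k and 0 elsewhere.  Only the
-- term m = k survives, and it is [k]_q! / k! · B_{k,l}(x,q) / xᵏ.  The power-series identity
-- follows by induction on k from (eᶻ - 1) · (eᶻ - 1)ᵏ / k! = (k + 1) (eᶻ - 1)ᵏ⁺¹ / (k + 1)!
-- and (eᶻ - 1) · z / (eᶻ - 1) = z, the latter read off the explicit formula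
-- B_m = Σⱼ Σᵢ (-1)ⁱ C(j,i) iᵐ / (j + 1) by telescoping.

module Submission where

open import Defs
open import Level using (Level)
open import Data.Nat as ℕ using (ℕ; zero; suc; _∸_; _≤_; _<_; z≤n; s≤s; _!; _≤?_)
import Data.Nat.Properties as ℕ
open import Data.Nat.Combinatorics using (_C_; nCk+nC[k+1]≡[n+1]C[k+1]; nC1≡n; k>n⇒nCk≡0)
open import Data.Sum using (inj₁; inj₂)
open import Relation.Nullary using (¬_; yes; no; contradiction)
open import Relation.Binary.PropositionalEquality using (_≢_)
open import Function using (_∘_)
import Relation.Binary.PropositionalEquality as ≡

[1+n]C[1+k]*[1+k]≡[1+n]*nCk : ∀ n k → (suc n C suc k) ℕ.* suc k ≡.≡ suc n ℕ.* (n C k)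
[1+n]C[1+k]*[1+k]≡[1+n]*nCk zero    zero    = ≡.refl
[1+n]C[1+k]*[1+k]≡[1+n]*nCk zero    (suc k) = ≡.refl
[1+n]C[1+k]*[1+k]≡[1+n]*nCk (suc n) zero    =
  ≡.trans (ℕ.*-identityʳ _) (≡.trans (nC1≡n (suc (suc n))) (≡.sym (ℕ.*-identityʳ _)))
[1+n]C[1+k]*[1+k]≡[1+n]*nCk (suc n) (suc k) = begin
  (suc (suc n) C suc (suc k)) ℕ.* suc (suc k)
    ≡⟨ ≡.cong (ℕ._* suc (suc k)) (≡.sym (nCk+nC[k+1]≡[n+1]C[k+1] (suc n) (suc k))) ⟩
  (A ℕ.+ B) ℕ.* suc (suc k)
    ≡⟨ ℕ.*-distribʳ-+ (suc (suc k)) A B ⟩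
  A ℕ.* suc (suc k) ℕ.+ B ℕ.* suc (suc k)
    ≡⟨ ≡.cong₂ ℕ._+_ (ℕ.*-suc A (suc k)) ([1+n]C[1+k]*[1+k]≡[1+n]*nCk n (suc k)) ⟩
  (A ℕ.+ A ℕ.* suc k) ℕ.+ suc n ℕ.* (n C suc k)
    ≡⟨ ≡.cong (λ t → (A ℕ.+ t) ℕ.+ suc n ℕ.* (n C suc k)) ([1+n]C[1+k]*[1+k]≡[1+n]*nCk n k) ⟩
  (A ℕ.+ suc n ℕ.* (n C k)) ℕ.+ suc n ℕ.* (n C suc k)
    ≡⟨ ℕ.+-assoc A _ _ ⟩
  A ℕ.+ (suc n ℕ.* (n C k) ℕ.+ suc n ℕ.* (n C suc k))
    ≡⟨ ≡.cong (A ℕ.+_) (≡.sym (ℕ.*-distribˡ-+ (suc n) (n C k) (n C suc k))) ⟩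
  A ℕ.+ suc n ℕ.* (n C k ℕ.+ n C suc k)
    ≡⟨ ≡.cong (λ t → A ℕ.+ suc n ℕ.* t) (nCk+nC[k+1]≡[n+1]C[k+1] n k) ⟩
  suc (suc n) ℕ.* A ∎
  where
  open ≡.≡-Reasoning
  A = suc n C suc k
  B = suc n C suc (suc k)

module QExpansion {c ℓ : Level} (F : Field c ℓ) where
  open Field F
  open FieldNotions F
  open import Relation.Binary.Reasoning.Setoid setoid
  open import Algebra.Properties.Ring ring using (-‿distribˡ-*; -‿distribʳ-*; -‿involutive; -0#≈0#; -‿+-comm; -1*x≈-x)
  open import Algebra.Properties.AbelianGroup +-abelianGroup using (⁻¹-anti-homo‿-; xyx⁻¹≈y)
  open import Algebra.Solver.Ring.NaturalCoefficients.Default commutativeSemiring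
    using (solve; _:=_; _:+_; _:*_)

  fromℕ-+ : ∀ a b → fromℕ (a ℕ.+ b) ≈ fromℕ a + fromℕ b
  fromℕ-+ zero    b = sym (+-identityˡ _)
  fromℕ-+ (suc a) b = trans (+-congˡ (fromℕ-+ a b)) (sym (+-assoc _ _ _))

  fromℕ-* : ∀ a b → fromℕ (a ℕ.* b) ≈ fromℕ a * fromℕ b
  fromℕ-* zero    b = sym (zeroˡ _)
  fromℕ-* (suc a) b = begin
    fromℕ (b ℕ.+ a ℕ.* b)      ≈⟨ fromℕ-+ b (a ℕ.* b) ⟩
    fromℕ b + fromℕ (a ℕ.* b)  ≈⟨ +-cong (sym (*-identityˡ _)) (fromℕ-* a b) ⟩
    1# * fromℕ b + fromℕ a * fromℕ b ≈⟨ sym (distribʳ _ _ _) ⟩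
    (1# + fromℕ a) * fromℕ b   ∎

  fromℕ-1 : fromℕ 1 ≈ 1#
  fromℕ-1 = +-identityʳ _

  pow-+ : ∀ a i j → pow a (i ℕ.+ j) ≈ pow a i * pow a j
  pow-+ a zero    j = sym (*-identityˡ _)
  pow-+ a (suc i) j = trans (*-congˡ (pow-+ a i j)) (sym (*-assoc _ _ _))

  pow-1# : ∀ m → pow 1# m ≈ 1#
  pow-1# zero    = refl
  pow-1# (suc m) = trans (*-identityˡ _) (pow-1# m)

  x-[x-y]≈y : ∀ x y → x - (x - y) ≈ y
  x-[x-y]≈y x y = trans (+-congˡ (⁻¹-anti-homo‿- x y)) (trans (sym (+-assoc _ _ _)) (xyx⁻¹≈y x y))

  sumTo-cong≤ : ∀ n {f g : ℕ → Carrier} → (∀ i → i ≤ n → f i ≈ g i) → sumTo n f ≈ sumTo n g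
  sumTo-cong≤ zero    f≈g = f≈g 0 z≤n
  sumTo-cong≤ (suc n) f≈g = +-cong (sumTo-cong≤ n (λ i i≤n → f≈g i (ℕ.m≤n⇒m≤1+n i≤n))) (f≈g (suc n) ℕ.≤-refl)

  sumTo-cong : ∀ n {f g : ℕ → Carrier} → (∀ i → f i ≈ g i) → sumTo n f ≈ sumTo n g
  sumTo-cong n f≈g = sumTo-cong≤ n (λ i _ → f≈g i)

  sumTo-+ : ∀ n (f g : ℕ → Carrier) → sumTo n (λ i → f i + g i) ≈ sumTo n f + sumTo n g
  sumTo-+ zero    f g = refl
  sumTo-+ (suc n) f g = trans (+-congʳ (sumTo-+ n f g))
    (solve 4 (λ a b c d → (a :+ b) :+ (c :+ d) := (a :+ c) :+ (b :+ d)) refl _ _ _ _)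

  *-distribˡ-sumTo : ∀ n a (f : ℕ → Carrier) → a * sumTo n f ≈ sumTo n (λ i → a * f i)
  *-distribˡ-sumTo zero    a f = refl
  *-distribˡ-sumTo (suc n) a f = trans (distribˡ _ _ _) (+-congʳ (*-distribˡ-sumTo n a f))

  -‿distrib-sumTo : ∀ n (f : ℕ → Carrier) → sumTo n (λ i → - f i) ≈ - sumTo n f
  -‿distrib-sumTo zero    f = refl
  -‿distrib-sumTo (suc n) f = trans (+-congʳ (-‿distrib-sumTo n f)) (-‿+-comm _ _)

  sumTo-≈0 : ∀ n {f : ℕ → Carrier} → (∀ i → i ≤ n → f i ≈ 0#) → sumTo n f ≈ 0#
  sumTo-≈0 n f≈0 = trans (sumTo-cong≤ n f≈0) (zeros n)
    where
    zeros : ∀ n → sumTo n (λ _ → 0#) ≈ 0#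
    zeros zero    = refl
    zeros (suc n) = trans (+-identityʳ _) (zeros n)

  sumTo-suc-head : ∀ n (f : ℕ → Carrier) → sumTo (suc n) f ≈ f 0 + sumTo n (λ i → f (suc i))
  sumTo-suc-head zero    f = refl
  sumTo-suc-head (suc n) f = trans (+-congʳ (sumTo-suc-head n f)) (+-assoc _ _ _)

  sumTo-extend : ∀ m n (f : ℕ → Carrier) → m ≤ n → (∀ j → m < j → f j ≈ 0#) → sumTo m f ≈ sumTo n f
  sumTo-extend m zero    f z≤n    _   = refl
  sumTo-extend m (suc n) f m≤1+n f≈0 with ℕ.m≤n⇒m<n∨m≡n m≤1+n
  ... | inj₂ ≡.refl = refl
  ... | inj₁ m<1+n  = begin
    sumTo m f                  ≈⟨ sumTo-extend m n f (ℕ.≤-pred m<1+n) f≈0 ⟩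
    sumTo n f                  ≈⟨ sym (+-identityʳ _) ⟩
    sumTo n f + 0#             ≈⟨ +-congˡ (sym (f≈0 (suc n) m<1+n)) ⟩
    sumTo n f + f (suc n)      ∎

  sumTo-telescope : ∀ n (g : ℕ → Carrier) → sumTo n (λ j → g j - g (suc j)) ≈ g 0 - g (suc n)
  sumTo-telescope zero    g = refl
  sumTo-telescope (suc n) g = begin
    sumTo n (λ j → g j - g (suc j)) + (g (suc n) - g (suc (suc n)))
      ≈⟨ +-congʳ (sumTo-telescope n g) ⟩
    (g 0 - g (suc n)) + (g (suc n) - g (suc (suc n)))
      ≈⟨ +-assoc _ _ _ ⟩
    g 0 + (- g (suc n) + (g (suc n) - g (suc (suc n))))
      ≈⟨ +-congˡ (sym (+-assoc _ _ _)) ⟩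
    g 0 + ((- g (suc n) + g (suc n)) - g (suc (suc n)))
      ≈⟨ +-congˡ (trans (+-congʳ (-‿inverseˡ _)) (+-identityˡ _)) ⟩
    g 0 - g (suc (suc n)) ∎

  δ : ℕ → ℕ → Carrier
  δ zero    zero    = 1#
  δ zero    (suc n) = 0#
  δ (suc k) zero    = 0#
  δ (suc k) (suc n) = δ k n

  δ-≢ : ∀ {k n} → k ≢ n → δ k n ≈ 0#
  δ-≢ {zero}  {zero}  k≢n = contradiction ≡.refl k≢n
  δ-≢ {zero}  {suc n} k≢n = refl
  δ-≢ {suc k} {zero}  k≢n = refl
  δ-≢ {suc k} {suc n} k≢n = δ-≢ (k≢n ∘ ≡.cong suc)

  δ-refl : ∀ k → δ k k ≈ 1#
  δ-refl zero    = refl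
  δ-refl (suc k) = δ-refl k

  *-δ-≢ : ∀ (f : ℕ → Carrier) {k m} → k ≢ m → f m * δ k m ≈ 0#
  *-δ-≢ f k≢m = trans (*-congˡ (δ-≢ k≢m)) (zeroʳ _)

  *-δ : ∀ (f : ℕ → Carrier) k m → f m * δ k m ≈ f k * δ k m
  *-δ f k m with k ℕ.≟ m
  ... | yes ≡.refl = refl
  ... | no  k≢m    = trans (*-δ-≢ f k≢m) (sym (*-δ-≢ (λ _ → f k) k≢m))

  sumTo-*δ : ∀ n k (h : ℕ → Carrier) → k ≤ n → sumTo n (λ m → h m * δ k m) ≈ h k
  sumTo-*δ n k h k≤n = begin
    sumTo n (λ m → h m * δ k m) ≈⟨ sym (sumTo-extend k n _ k≤n (λ j k<j → *-δ-≢ h (ℕ.<⇒≢ k<j))) ⟩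
    sumTo k (λ m → h m * δ k m) ≈⟨ last k ⟩
    h k                         ∎
    where
    last : ∀ k → sumTo k (λ m → h m * δ k m) ≈ h k
    last zero    = trans (*-congˡ (δ-refl 0)) (*-identityʳ _)
    last (suc k) = begin
      sumTo k (λ m → h m * δ (suc k) m) + h (suc k) * δ (suc k) (suc k)
        ≈⟨ +-cong (sumTo-≈0 k (λ m m≤k → *-δ-≢ h (ℕ.<⇒≢ (s≤s m≤k) ∘ ≡.sym)))
                  (trans (*-congˡ (δ-refl k)) (*-identityʳ _)) ⟩
      0# + h (suc k) ≈⟨ +-identityˡ _ ⟩
      h (suc k)      ∎

  sumTo-*δ-> : ∀ n k (h : ℕ → Carrier) → n < k → sumTo n (λ m → h m * δ k m) ≈ 0#
  sumTo-*δ-> n k h n<k = sumTo-≈0 n (λ m m≤n → *-δ-≢ h (ℕ.<⇒≢ (ℕ.≤-<-trans m≤n n<k) ∘ ≡.sym))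

  qint-suc : ∀ q n → qint q (suc n) ≈ 1# + q * qint q n
  qint-suc q zero    = trans (+-identityˡ _) (sym (trans (+-congˡ (zeroʳ q)) (+-identityʳ _)))
  qint-suc q (suc n) = begin
    qint q (suc n) + q * pow q n      ≈⟨ +-congʳ (qint-suc q n) ⟩
    (1# + q * qint q n) + q * pow q n ≈⟨ +-assoc _ _ _ ⟩
    1# + (q * qint q n + q * pow q n) ≈⟨ +-congˡ (sym (distribˡ _ _ _)) ⟩
    1# + q * (qint q n + pow q n)     ∎

  qint-+ : ∀ q a b → qint q (a ℕ.+ b) ≈ qint q a + pow q a * qint q b
  qint-+ q zero    b = sym (trans (+-identityˡ _) (*-identityˡ _))
  qint-+ q (suc a) b = begin
    qint q (suc (a ℕ.+ b))                    ≈⟨ qint-suc q (a ℕ.+ b) ⟩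
    1# + q * qint q (a ℕ.+ b)                 ≈⟨ +-congˡ (*-congˡ (qint-+ q a b)) ⟩
    1# + q * (qint q a + pow q a * qint q b)
      ≈⟨ solve 5 (λ o q i p j → o :+ q :* (i :+ p :* j) := (o :+ q :* i) :+ q :* p :* j) refl _ _ _ _ _ ⟩
    (1# + q * qint q a) + q * pow q a * qint q b ≈⟨ +-congʳ (sym (qint-suc q a)) ⟩
    qint q (suc a) + pow q (suc a) * qint q b    ∎

  qbinom-> : ∀ q {n m} → n < m → qbinom q n m ≈ 0#
  qbinom-> q {zero}  {suc m} _         = refl
  qbinom-> q {suc n} {suc m} (s≤s n<m) = begin
    qbinom q n m + pow q (suc m) * qbinom q n (suc m) ≈⟨ +-cong (qbinom-> q n<m) (*-congˡ (qbinom-> q (ℕ.m≤n⇒m≤1+n n<m))) ⟩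
    0# + pow q (suc m) * 0#                           ≈⟨ trans (+-identityˡ _) (zeroʳ _) ⟩
    0#                                                ∎

  qbinom-qfact : ∀ q m d → qbinom q (m ℕ.+ d) m * qfact q m * qfact q d ≈ qfact q (m ℕ.+ d)
  qbinom-qfact q zero    d = trans (*-congʳ (*-identityˡ _)) (*-identityˡ _)
  qbinom-qfact q (suc m) d = begin
    (qbinom q (m ℕ.+ d) m + pow q (suc m) * qbinom q (m ℕ.+ d) (suc m)) * (qfact q m * qint q (suc m)) * qfact q d
      ≈⟨ solve 6 (λ b p b′ f i g → (b :+ p :* b′) :* (f :* i) :* g
                                  := i :* (b :* f :* g) :+ p :* (b′ :* (f :* i) :* g)) refl _ _ _ _ _ _ ⟩
    qint q (suc m) * (qbinom q (m ℕ.+ d) m * qfact q m * qfact q d)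
      + pow q (suc m) * (qbinom q (m ℕ.+ d) (suc m) * qfact q (suc m) * qfact q d)
      ≈⟨ +-cong (*-congˡ (qbinom-qfact q m d)) (*-congˡ (upper d)) ⟩
    qint q (suc m) * qfact q (m ℕ.+ d) + pow q (suc m) * (qint q d * qfact q (m ℕ.+ d))
      ≈⟨ solve 4 (λ i p j f → i :* f :+ p :* (j :* f) := (i :+ p :* j) :* f) refl _ _ _ _ ⟩
    (qint q (suc m) + pow q (suc m) * qint q d) * qfact q (m ℕ.+ d)
      ≈⟨ *-congʳ (sym (qint-+ q (suc m) d)) ⟩
    qint q (suc m ℕ.+ d) * qfact q (m ℕ.+ d)
      ≈⟨ *-comm _ _ ⟩
    qfact q (suc m ℕ.+ d) ∎
    where
    upper : ∀ d → qbinom q (m ℕ.+ d) (suc m) * qfact q (suc m) * qfact q d ≈ qint q d * qfact q (m ℕ.+ d)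
    upper zero = begin
      qbinom q (m ℕ.+ 0) (suc m) * qfact q (suc m) * 1#
        ≈⟨ *-congʳ (*-congʳ (qbinom-> q (s≤s (ℕ.≤-reflexive (ℕ.+-identityʳ m))))) ⟩
      0# * qfact q (suc m) * 1# ≈⟨ trans (*-congʳ (zeroˡ _)) (zeroˡ _) ⟩
      0#                        ≈⟨ sym (zeroˡ _) ⟩
      0# * qfact q (m ℕ.+ 0)    ∎
    upper (suc d) rewrite ℕ.+-suc m d = begin
      qbinom q (suc m ℕ.+ d) (suc m) * qfact q (suc m) * (qfact q d * qint q (suc d))
        ≈⟨ solve 4 (λ b f g i → b :* f :* (g :* i) := i :* (b :* f :* g)) refl _ _ _ _ ⟩
      qint q (suc d) * (qbinom q (suc m ℕ.+ d) (suc m) * qfact q (suc m) * qfact q d)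
        ≈⟨ *-congˡ (qbinom-qfact q (suc m) d) ⟩
      qint q (suc d) * qfact q (suc m ℕ.+ d) ∎

  qbinom-qfact-∸ : ∀ q {n m} → m ≤ n → qbinom q n m * qfact q m * qfact q (n ∸ m) ≈ qfact q n
  qbinom-qfact-∸ q {n} {m} m≤n =
    ≡.subst (λ t → qbinom q t m * qfact q m * qfact q (n ∸ m) ≈ qfact q t)
            (ℕ.m+[n∸m]≡n m≤n) (qbinom-qfact q m (n ∸ m))

  qint-1# : ∀ n → qint 1# n ≈ fromℕ n
  qint-1# zero    = refl
  qint-1# (suc n) = trans (+-cong (qint-1# n) (pow-1# n)) (+-comm _ _)

  qfact-1# : ∀ n → qfact 1# n ≈ fromℕ (n !)
  qfact-1# zero    = sym fromℕ-1
  qfact-1# (suc n) = begin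
    qfact 1# n * qint 1# (suc n)   ≈⟨ *-cong (qfact-1# n) (qint-1# (suc n)) ⟩
    fromℕ (n !) * fromℕ (suc n)    ≈⟨ *-comm _ _ ⟩
    fromℕ (suc n) * fromℕ (n !)    ≈⟨ sym (fromℕ-* (suc n) (n !)) ⟩
    fromℕ (suc n !)                ∎

  qbinom-1# : ∀ n m → qbinom 1# n m ≈ fromℕ (n C m)
  qbinom-1# n       zero    = sym fromℕ-1
  qbinom-1# zero    (suc m) = refl
  qbinom-1# (suc n) (suc m) = begin
    qbinom 1# n m + pow 1# (suc m) * qbinom 1# n (suc m)
      ≈⟨ +-cong (qbinom-1# n m) (trans (*-congʳ (pow-1# (suc m))) (trans (*-identityˡ _) (qbinom-1# n (suc m)))) ⟩
    fromℕ (n C m) + fromℕ (n C suc m) ≈⟨ sym (fromℕ-+ (n C m) (n C suc m)) ⟩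
    fromℕ (n C m ℕ.+ n C suc m)       ≡⟨ ≡.cong fromℕ (nCk+nC[k+1]≡[n+1]C[k+1] n m) ⟩
    fromℕ (suc n C suc m)             ∎

  Seq : Set c
  Seq = ℕ → Carrier

  shift : Seq → Seq
  shift f n = f (suc n)

  -- shift is the q-derivative and dilate is z ↦ q z.
  module Convolution (q : Carrier) where

    infixl 7 _⋆_
    _⋆_ : Seq → Seq → Seq
    (f ⋆ g) n = sumTo n (λ m → qbinom q n m * f m * g (n ∸ m))

    dilate : Seq → Seq
    dilate f n = pow q n * f n

    ⋆-cong : ∀ {f f′ g g′ : Seq} → (∀ i → f i ≈ f′ i) → (∀ i → g i ≈ g′ i) →
             ∀ n → (f ⋆ g) n ≈ (f′ ⋆ g′) n
    ⋆-cong f≈f′ g≈g′ n = sumTo-cong n (λ m → *-cong (*-congˡ (f≈f′ m)) (g≈g′ (n ∸ m)))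

    ⋆-congˡ : ∀ {f f′} (g : Seq) → (∀ i → f i ≈ f′ i) → ∀ n → (f ⋆ g) n ≈ (f′ ⋆ g) n
    ⋆-congˡ g f≈f′ = ⋆-cong {g = g} f≈f′ (λ _ → refl)

    ⋆-congʳ : ∀ (f : Seq) {g g′} → (∀ i → g i ≈ g′ i) → ∀ n → (f ⋆ g) n ≈ (f ⋆ g′) n
    ⋆-congʳ f = ⋆-cong (λ _ → refl)

    ⋆-congʳ≤ : ∀ (f : Seq) {g g′ : Seq} n → (∀ i → i ≤ n → g i ≈ g′ i) → (f ⋆ g) n ≈ (f ⋆ g′) n
    ⋆-congʳ≤ f n g≈g′ = sumTo-cong n (λ m → *-congˡ (g≈g′ (n ∸ m) (ℕ.m∸n≤m n m)))

    ⋆-distribʳ-+ : ∀ (f g h : Seq) n → ((λ i → f i + g i) ⋆ h) n ≈ (f ⋆ h) n + (g ⋆ h) n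
    ⋆-distribʳ-+ f g h n = trans (sumTo-cong n (λ m → trans (*-congʳ (distribˡ _ _ _)) (distribʳ _ _ _))) (sumTo-+ n _ _)

    ⋆-distribˡ-+ : ∀ (f g h : Seq) n → (f ⋆ (λ i → g i + h i)) n ≈ (f ⋆ g) n + (f ⋆ h) n
    ⋆-distribˡ-+ f g h n = trans (sumTo-cong n (λ m → distribˡ _ _ _)) (sumTo-+ n _ _)

    ⋆-*ˡ : ∀ a (f g : Seq) n → ((λ i → a * f i) ⋆ g) n ≈ a * (f ⋆ g) n
    ⋆-*ˡ a f g n = trans (sumTo-cong n (λ m → solve 4 (λ a b f g → b :* (a :* f) :* g := a :* (b :* f :* g)) refl _ _ _ _))
                         (sym (*-distribˡ-sumTo n a _))

    ⋆-*ʳ : ∀ a (f g : Seq) n → (f ⋆ (λ i → a * g i)) n ≈ a * (f ⋆ g) n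
    ⋆-*ʳ a f g n = trans (sumTo-cong n (λ m → solve 4 (λ a b f g → b :* f :* (a :* g) := a :* (b :* f :* g)) refl _ _ _ _))
                         (sym (*-distribˡ-sumTo n a _))

    ⋆-negˡ : ∀ (f g : Seq) n → ((λ i → - f i) ⋆ g) n ≈ - (f ⋆ g) n
    ⋆-negˡ f g n = trans (sumTo-cong n (λ m → trans (*-congʳ (sym (-‿distribʳ-* _ _))) (sym (-‿distribˡ-* _ _))))
                         (-‿distrib-sumTo n _)

    ⋆-sumTo : ∀ (f : Seq) (w : ℕ → Carrier) (g : ℕ → Seq) j n →
              (f ⋆ (λ m → sumTo j (λ i → w i * g i m))) n ≈ sumTo j (λ i → w i * (f ⋆ g i) n)
    ⋆-sumTo f w g zero    n = ⋆-*ʳ (w 0) f (g 0) n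
    ⋆-sumTo f w g (suc j) n =
      trans (⋆-distribˡ-+ f (λ m → sumTo j (λ i → w i * g i m)) (λ m → w (suc j) * g (suc j) m) n)
            (+-cong (⋆-sumTo f w g j n) (⋆-*ʳ (w (suc j)) f (g (suc j)) n))

    δ-⋆ : ∀ {k n} (g : Seq) → k ≤ n → (δ k ⋆ g) n ≈ qbinom q n k * g (n ∸ k)
    δ-⋆ {k} {n} g k≤n = trans (sumTo-cong n (λ m → solve 3 (λ b d g → b :* d :* g := b :* g :* d) refl _ _ _))
                              (sumTo-*δ n k _ k≤n)

    δ-⋆-> : ∀ {k n} (g : Seq) → n < k → (δ k ⋆ g) n ≈ 0#
    δ-⋆-> {k} {n} g n<k = trans (sumTo-cong n (λ m → solve 3 (λ b d g → b :* d :* g := b :* g :* d) refl _ _ _))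
                                (sumTo-*δ-> n k _ n<k)

    δ0-⋆ : ∀ (g : Seq) n → (δ 0 ⋆ g) n ≈ g n
    δ0-⋆ g n = trans (δ-⋆ g z≤n) (*-identityˡ _)

    dilate-⋆ : ∀ (f g : Seq) n → pow q n * (f ⋆ g) n ≈ (dilate f ⋆ dilate g) n
    dilate-⋆ f g n = trans (*-distribˡ-sumTo n _ _) (sumTo-cong≤ n (λ m m≤n → begin
      pow q n * (qbinom q n m * f m * g (n ∸ m))
        ≡⟨ ≡.cong (λ t → pow q t * (qbinom q n m * f m * g (n ∸ m))) (≡.sym (ℕ.m+[n∸m]≡n m≤n)) ⟩
      pow q (m ℕ.+ (n ∸ m)) * (qbinom q n m * f m * g (n ∸ m))
        ≈⟨ *-congʳ (pow-+ q m (n ∸ m)) ⟩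
      pow q m * pow q (n ∸ m) * (qbinom q n m * f m * g (n ∸ m))
        ≈⟨ solve 5 (λ p p′ b f g → p :* p′ :* (b :* f :* g) := b :* (p :* f) :* (p′ :* g)) refl _ _ _ _ _ ⟩
      qbinom q n m * dilate f m * dilate g (n ∸ m) ∎))

    -- The q-Pascal rule behind qbinom makes shift a twisted derivation of _⋆_.
    ⋆-leibniz : ∀ (f g : Seq) n → (f ⋆ g) (suc n) ≈ (shift f ⋆ g) n + (dilate f ⋆ shift g) n
    ⋆-leibniz f g n = begin
      (f ⋆ g) (suc n)
        ≈⟨ sumTo-suc-head n _ ⟩
      head + sumTo n (λ m → (qbinom q n m + pow q (suc m) * qbinom q n (suc m)) * f (suc m) * g (n ∸ m))
        ≈⟨ +-congˡ (trans (sumTo-cong n (λ m → pascal-split)) (sumTo-+ n _ _)) ⟩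
      head + ((shift f ⋆ g) n + twisted)
        ≈⟨ solve 3 (λ h s t → h :+ (s :+ t) := s :+ (h :+ t)) refl _ _ _ ⟩
      (shift f ⋆ g) n + (head + twisted)
        ≈⟨ +-congˡ tail ⟩
      (shift f ⋆ g) n + (dilate f ⋆ shift g) n ∎
      where
      pascal-split : ∀ {b p b′ f g} → (b + p * b′) * f * g ≈ b * f * g + p * b′ * f * g
      pascal-split = solve 5 (λ b p b′ f g → (b :+ p :* b′) :* f :* g := b :* f :* g :+ p :* b′ :* f :* g) refl _ _ _ _ _
      head    = 1# * f 0 * g (suc n)
      twisted = sumTo n (λ m → pow q (suc m) * qbinom q n (suc m) * f (suc m) * g (n ∸ m))
      term : ℕ → Carrier
      term m = qbinom q n m * dilate f m * g (suc n ∸ m)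
      tail : head + twisted ≈ (dilate f ⋆ shift g) n
      tail = begin
        head + twisted
          ≈⟨ +-cong (*-congʳ (*-congˡ (sym (*-identityˡ _))))
                    (sumTo-cong n (λ m → solve 4 (λ p b f g → p :* b :* f :* g := b :* (p :* f) :* g) refl _ _ _ _)) ⟩
        term 0 + sumTo n (λ m → term (suc m))
          ≈⟨ sym (sumTo-suc-head n term) ⟩
        sumTo (suc n) term
          ≈⟨ sym (sumTo-extend n (suc n) term (ℕ.n≤1+n n) last) ⟩
        sumTo n term
          ≈⟨ sumTo-cong≤ n (λ m m≤n → *-congˡ (reflexive (≡.cong g (ℕ.+-∸-assoc 1 m≤n)))) ⟩
        (dilate f ⋆ shift g) n ∎
        where
        last : ∀ j → n < j → term j ≈ 0#
        last j n<j = trans (*-congʳ (*-congʳ (qbinom-> q n<j))) (trans (*-congʳ (zeroˡ _)) (zeroˡ _))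

    ⋆-assoc : ∀ n (f g h : Seq) → ((f ⋆ g) ⋆ h) n ≈ (f ⋆ (g ⋆ h)) n
    ⋆-assoc zero    f g h = solve 4 (λ b f g h → b :* (b :* f :* g) :* h := b :* f :* (b :* g :* h)) refl _ _ _ _
    ⋆-assoc (suc n) f g h = begin
      ((f ⋆ g) ⋆ h) (suc n)
        ≈⟨ ⋆-leibniz (f ⋆ g) h n ⟩
      (shift (f ⋆ g) ⋆ h) n + (dilate (f ⋆ g) ⋆ shift h) n
        ≈⟨ +-cong (⋆-congˡ h (⋆-leibniz f g) n) (⋆-congˡ (shift h) (dilate-⋆ f g) n) ⟩
      ((λ i → (shift f ⋆ g) i + (dilate f ⋆ shift g) i) ⋆ h) n + ((dilate f ⋆ dilate g) ⋆ shift h) n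
        ≈⟨ +-congʳ (⋆-distribʳ-+ (shift f ⋆ g) (dilate f ⋆ shift g) h n) ⟩
      (((shift f ⋆ g) ⋆ h) n + ((dilate f ⋆ shift g) ⋆ h) n) + ((dilate f ⋆ dilate g) ⋆ shift h) n
        ≈⟨ +-cong (+-cong (⋆-assoc n (shift f) g h) (⋆-assoc n (dilate f) (shift g) h)) (⋆-assoc n (dilate f) (dilate g) (shift h)) ⟩
      ((shift f ⋆ (g ⋆ h)) n + (dilate f ⋆ (shift g ⋆ h)) n) + (dilate f ⋆ (dilate g ⋆ shift h)) n
        ≈⟨ +-assoc _ _ _ ⟩
      (shift f ⋆ (g ⋆ h)) n + ((dilate f ⋆ (shift g ⋆ h)) n + (dilate f ⋆ (dilate g ⋆ shift h)) n)
        ≈⟨ +-congˡ (sym (⋆-distribˡ-+ (dilate f) (shift g ⋆ h) (dilate g ⋆ shift h) n)) ⟩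
      (shift f ⋆ (g ⋆ h)) n + (dilate f ⋆ (λ i → (shift g ⋆ h) i + (dilate g ⋆ shift h) i)) n
        ≈⟨ +-congˡ (⋆-congʳ (dilate f) (λ i → sym (⋆-leibniz g h i)) n) ⟩
      (shift f ⋆ (g ⋆ h)) n + (dilate f ⋆ shift (g ⋆ h)) n
        ≈⟨ sym (⋆-leibniz f (g ⋆ h) n) ⟩
      (f ⋆ (g ⋆ h)) (suc n) ∎

  open Convolution 1#

  dilate-1# : ∀ (f : Seq) i → dilate f i ≈ f i
  dilate-1# f i = trans (*-congʳ (pow-1# i)) (*-identityˡ _)

  ⋆-leibniz₁ : ∀ (f g : Seq) n → (f ⋆ g) (suc n) ≈ (shift f ⋆ g) n + (f ⋆ shift g) n
  ⋆-leibniz₁ f g n = trans (⋆-leibniz f g n) (+-congˡ (⋆-congˡ (shift g) (dilate-1# f) n))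

  ⋆-comm : ∀ n (f g : Seq) → (f ⋆ g) n ≈ (g ⋆ f) n
  ⋆-comm zero    f g = solve 3 (λ b f g → b :* f :* g := b :* g :* f) refl _ _ _
  ⋆-comm (suc n) f g = begin
    (f ⋆ g) (suc n)                     ≈⟨ ⋆-leibniz₁ f g n ⟩
    (shift f ⋆ g) n + (f ⋆ shift g) n   ≈⟨ +-cong (⋆-comm n (shift f) g) (⋆-comm n f (shift g)) ⟩
    (g ⋆ shift f) n + (shift g ⋆ f) n   ≈⟨ +-comm _ _ ⟩
    (shift g ⋆ f) n + (g ⋆ shift f) n   ≈⟨ sym (⋆-leibniz₁ g f n) ⟩
    (g ⋆ f) (suc n)                     ∎

  ⋆-interchange : ∀ n (f g h k : Seq) → ((f ⋆ g) ⋆ (h ⋆ k)) n ≈ ((f ⋆ h) ⋆ (g ⋆ k)) n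
  ⋆-interchange n f g h k = begin
    ((f ⋆ g) ⋆ (h ⋆ k)) n ≈⟨ ⋆-assoc n f g (h ⋆ k) ⟩
    (f ⋆ (g ⋆ (h ⋆ k))) n ≈⟨ ⋆-congʳ f (λ i → sym (⋆-assoc i g h k)) n ⟩
    (f ⋆ ((g ⋆ h) ⋆ k)) n ≈⟨ ⋆-congʳ f (⋆-congˡ k (λ j → ⋆-comm j g h)) n ⟩
    (f ⋆ ((h ⋆ g) ⋆ k)) n ≈⟨ ⋆-congʳ f (λ i → ⋆-assoc i h g k) n ⟩
    (f ⋆ (h ⋆ (g ⋆ k))) n ≈⟨ sym (⋆-assoc n f h (g ⋆ k)) ⟩
    ((f ⋆ h) ⋆ (g ⋆ k)) n ∎

  δ1-⋆-δ : ∀ k n → (δ 1 ⋆ δ k) n ≈ fromℕ (suc k) * δ (suc k) n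
  δ1-⋆-δ k zero    = trans (δ-⋆-> {k = 1} (δ k) (s≤s z≤n)) (sym (zeroʳ _))
  δ1-⋆-δ k (suc n) = begin
    (δ 1 ⋆ δ k) (suc n)            ≈⟨ δ-⋆ (δ k) (s≤s z≤n) ⟩
    qbinom 1# (suc n) 1 * δ k n    ≈⟨ *-congʳ (trans (qbinom-1# (suc n) 1) (reflexive (≡.cong fromℕ (nC1≡n (suc n))))) ⟩
    fromℕ (suc n) * δ k n          ≈⟨ *-δ (fromℕ ∘ suc) k n ⟩
    fromℕ (suc k) * δ k n          ∎

  -- Coefficients of e^(iz), eᶻ - 1, (1 - eᶻ)ʲ = Σᵢ (-1)ⁱ C(j,i) e^(iz) and eᶻ (1 - eᶻ)ʲ.
  exp^ : ℕ → Seq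
  exp^ i m = fromℕ (i ℕ.^ m)

  expm1 : Seq
  expm1 zero    = 0#
  expm1 (suc m) = 1#

  [1-exp]^ : ℕ → Seq
  [1-exp]^ j m = sumTo j (λ i → pow (- 1#) i * fromℕ (j C i) * exp^ i m)

  exp*[1-exp]^ : ℕ → Seq
  exp*[1-exp]^ j m = sumTo j (λ i → pow (- 1#) i * fromℕ (j C i) * exp^ (suc i) m)

  exp^-⋆ : ∀ a b m → (exp^ a ⋆ exp^ b) m ≈ exp^ (a ℕ.+ b) m
  exp^-⋆ a b zero    = trans (*-cong (*-congˡ fromℕ-1) fromℕ-1)
                             (trans (*-identityʳ _) (trans (*-identityʳ _) (sym fromℕ-1)))
  exp^-⋆ a b (suc m) = begin
    (exp^ a ⋆ exp^ b) (suc m)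
      ≈⟨ ⋆-leibniz₁ (exp^ a) (exp^ b) m ⟩
    (shift (exp^ a) ⋆ exp^ b) m + (exp^ a ⋆ shift (exp^ b)) m
      ≈⟨ +-cong (⋆-congˡ (exp^ b) (λ i → fromℕ-* a (a ℕ.^ i)) m)
                (⋆-congʳ (exp^ a) (λ i → fromℕ-* b (b ℕ.^ i)) m) ⟩
    ((λ i → fromℕ a * exp^ a i) ⋆ exp^ b) m + (exp^ a ⋆ (λ i → fromℕ b * exp^ b i)) m
      ≈⟨ +-cong (⋆-*ˡ _ (exp^ a) (exp^ b) m) (⋆-*ʳ _ (exp^ a) (exp^ b) m) ⟩
    fromℕ a * (exp^ a ⋆ exp^ b) m + fromℕ b * (exp^ a ⋆ exp^ b) m
      ≈⟨ sym (distribʳ _ _ _) ⟩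
    (fromℕ a + fromℕ b) * (exp^ a ⋆ exp^ b) m
      ≈⟨ *-cong (sym (fromℕ-+ a b)) (exp^-⋆ a b m) ⟩
    fromℕ (a ℕ.+ b) * exp^ (a ℕ.+ b) m
      ≈⟨ sym (fromℕ-* (a ℕ.+ b) _) ⟩
    exp^ (a ℕ.+ b) (suc m) ∎

  exp^0≈δ0 : ∀ m → exp^ 0 m ≈ δ 0 m
  exp^0≈δ0 zero    = fromℕ-1
  exp^0≈δ0 (suc m) = refl

  expm1≈exp^1-exp^0 : ∀ m → expm1 m ≈ exp^ 1 m - exp^ 0 m
  expm1≈exp^1-exp^0 zero    = sym (-‿inverseʳ _)
  expm1≈exp^1-exp^0 (suc m) = sym (begin
    fromℕ (1 ℕ.^ suc m) - 0#  ≡⟨ ≡.cong (λ t → fromℕ t - 0#) (ℕ.^-zeroˡ (suc m)) ⟩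
    fromℕ 1 - 0#              ≈⟨ +-cong fromℕ-1 -0#≈0# ⟩
    1# + 0#                   ≈⟨ +-identityʳ _ ⟩
    1#                        ∎)

  exp^1-⋆-[1-exp]^ : ∀ j m → (exp^ 1 ⋆ [1-exp]^ j) m ≈ exp*[1-exp]^ j m
  exp^1-⋆-[1-exp]^ j m = trans (⋆-sumTo (exp^ 1) (λ i → pow (- 1#) i * fromℕ (j C i)) exp^ j m)
                               (sumTo-cong j (λ i → *-congˡ (exp^-⋆ 1 i m)))

  [1-exp]^-suc : ∀ j m → [1-exp]^ (suc j) m ≈ [1-exp]^ j m - exp*[1-exp]^ j m
  [1-exp]^-suc j m = begin
    [1-exp]^ (suc j) m
      ≈⟨ sumTo-suc-head j _ ⟩
    h + sumTo j (λ i → pow (- 1#) (suc i) * fromℕ (suc j C suc i) * exp^ (suc i) m)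
      ≈⟨ +-congˡ (sumTo-cong j pascal) ⟩
    h + sumTo j (λ i → t i + - d i)
      ≈⟨ +-congˡ (trans (sumTo-+ j t _) (+-congˡ (-‿distrib-sumTo j d))) ⟩
    h + (sumTo j t - exp*[1-exp]^ j m)
      ≈⟨ sym (+-assoc _ _ _) ⟩
    (h + sumTo j t) - exp*[1-exp]^ j m
      ≈⟨ +-congʳ (sym expand) ⟩
    [1-exp]^ j m - exp*[1-exp]^ j m ∎
    where
    h = 1# * fromℕ 1 * exp^ 0 m
    t d : ℕ → Carrier
    t i = pow (- 1#) (suc i) * fromℕ (j C suc i) * exp^ (suc i) m
    d i = pow (- 1#) i * fromℕ (j C i) * exp^ (suc i) m
    expand : [1-exp]^ j m ≈ h + sumTo j t
    expand = begin
      [1-exp]^ j m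
        ≈⟨ sumTo-extend j (suc j) _ (ℕ.n≤1+n j) beyond ⟩
      sumTo (suc j) (λ i → pow (- 1#) i * fromℕ (j C i) * exp^ i m)
        ≈⟨ sumTo-suc-head j _ ⟩
      h + sumTo j t ∎
      where
      beyond : ∀ i → j < i → pow (- 1#) i * fromℕ (j C i) * exp^ i m ≈ 0#
      beyond i j<i = trans (*-congʳ (trans (*-congˡ (reflexive (≡.cong fromℕ (k>n⇒nCk≡0 j<i)))) (zeroʳ _))) (zeroˡ _)
    pascal : ∀ i → pow (- 1#) (suc i) * fromℕ (suc j C suc i) * exp^ (suc i) m ≈ t i + - d i
    pascal i = begin
      - 1# * pow (- 1#) i * fromℕ (suc j C suc i) * exp^ (suc i) m
        ≡⟨ ≡.cong (λ c → - 1# * pow (- 1#) i * fromℕ c * exp^ (suc i) m) (≡.sym (nCk+nC[k+1]≡[n+1]C[k+1] j i)) ⟩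
      - 1# * pow (- 1#) i * fromℕ (j C i ℕ.+ j C suc i) * exp^ (suc i) m
        ≈⟨ *-congʳ (*-congˡ (fromℕ-+ (j C i) (j C suc i))) ⟩
      - 1# * pow (- 1#) i * (fromℕ (j C i) + fromℕ (j C suc i)) * exp^ (suc i) m
        ≈⟨ solve 5 (λ n p a b e → n :* p :* (a :+ b) :* e := n :* p :* b :* e :+ n :* (p :* a :* e)) refl _ _ _ _ _ ⟩
      t i + - 1# * d i
        ≈⟨ +-congˡ (-1*x≈-x _) ⟩
      t i + - d i ∎

  shift-[1-exp]^-suc : ∀ j m → shift ([1-exp]^ (suc j)) m ≈ - (fromℕ (suc j) * exp*[1-exp]^ j m)
  shift-[1-exp]^-suc j m = begin
    shift ([1-exp]^ (suc j)) m
      ≈⟨ sumTo-suc-head j _ ⟩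
    1# * fromℕ 1 * 0# + sumTo j (λ i → pow (- 1#) (suc i) * fromℕ (suc j C suc i) * exp^ (suc i) (suc m))
      ≈⟨ +-cong (zeroʳ _) (sumTo-cong j term) ⟩
    0# + sumTo j (λ i → - (fromℕ (suc j) * d i))
      ≈⟨ trans (+-identityˡ _) (-‿distrib-sumTo j _) ⟩
    - sumTo j (λ i → fromℕ (suc j) * d i)
      ≈⟨ -‿cong (sym (*-distribˡ-sumTo j _ d)) ⟩
    - (fromℕ (suc j) * exp*[1-exp]^ j m) ∎
    where
    d : ℕ → Carrier
    d i = pow (- 1#) i * fromℕ (j C i) * exp^ (suc i) m
    absorb : ∀ i → fromℕ (suc j C suc i) * fromℕ (suc i) ≈ fromℕ (suc j) * fromℕ (j C i)
    absorb i = begin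
      fromℕ (suc j C suc i) * fromℕ (suc i) ≈⟨ sym (fromℕ-* (suc j C suc i) (suc i)) ⟩
      fromℕ ((suc j C suc i) ℕ.* suc i)     ≡⟨ ≡.cong fromℕ ([1+n]C[1+k]*[1+k]≡[1+n]*nCk j i) ⟩
      fromℕ (suc j ℕ.* (j C i))             ≈⟨ fromℕ-* (suc j) (j C i) ⟩
      fromℕ (suc j) * fromℕ (j C i)         ∎
    term : ∀ i → pow (- 1#) (suc i) * fromℕ (suc j C suc i) * exp^ (suc i) (suc m) ≈ - (fromℕ (suc j) * d i)
    term i = begin
      - 1# * pow (- 1#) i * fromℕ (suc j C suc i) * fromℕ (suc i ℕ.* suc i ℕ.^ m)
        ≈⟨ *-congˡ (fromℕ-* (suc i) (suc i ℕ.^ m)) ⟩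
      - 1# * pow (- 1#) i * fromℕ (suc j C suc i) * (fromℕ (suc i) * exp^ (suc i) m)
        ≈⟨ solve 5 (λ n p c s e → n :* p :* c :* (s :* e) := n :* ((c :* s) :* (p :* e))) refl _ _ _ _ _ ⟩
      - 1# * ((fromℕ (suc j C suc i) * fromℕ (suc i)) * (pow (- 1#) i * exp^ (suc i) m))
        ≈⟨ *-congˡ (*-congʳ (absorb i)) ⟩
      - 1# * ((fromℕ (suc j) * fromℕ (j C i)) * (pow (- 1#) i * exp^ (suc i) m))
        ≈⟨ *-congˡ (solve 4 (λ s c p e → (s :* c) :* (p :* e) := s :* (p :* c :* e)) refl _ _ _ _) ⟩
      - 1# * (fromℕ (suc j) * d i)
        ≈⟨ -1*x≈-x _ ⟩
      - (fromℕ (suc j) * d i) ∎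

  expm1-⋆-[1-exp]^ : ∀ j m → (expm1 ⋆ [1-exp]^ j) m ≈ - [1-exp]^ (suc j) m
  expm1-⋆-[1-exp]^ j m = begin
    (expm1 ⋆ [1-exp]^ j) m
      ≈⟨ ⋆-congˡ ([1-exp]^ j) expm1≈exp^1-exp^0 m ⟩
    ((λ i → exp^ 1 i - exp^ 0 i) ⋆ [1-exp]^ j) m
      ≈⟨ ⋆-distribʳ-+ (exp^ 1) (λ i → - exp^ 0 i) ([1-exp]^ j) m ⟩
    (exp^ 1 ⋆ [1-exp]^ j) m + ((λ i → - exp^ 0 i) ⋆ [1-exp]^ j) m
      ≈⟨ +-cong (exp^1-⋆-[1-exp]^ j m) (⋆-negˡ (exp^ 0) ([1-exp]^ j) m) ⟩
    exp*[1-exp]^ j m - (exp^ 0 ⋆ [1-exp]^ j) m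
      ≈⟨ +-congˡ (-‿cong (trans (⋆-congˡ ([1-exp]^ j) exp^0≈δ0 m) (δ0-⋆ ([1-exp]^ j) m))) ⟩
    exp*[1-exp]^ j m - [1-exp]^ j m
      ≈⟨ sym (⁻¹-anti-homo‿- _ _) ⟩
    - ([1-exp]^ j m - exp*[1-exp]^ j m)
      ≈⟨ -‿cong (sym ([1-exp]^-suc j m)) ⟩
    - [1-exp]^ (suc j) m ∎

  [1-exp]^-< : ∀ {j m} → m < j → [1-exp]^ j m ≈ 0#
  [1-exp]^-< {suc j} {m} m<1+j = begin
    [1-exp]^ (suc j) m           ≈⟨ sym (-‿involutive _) ⟩
    - - [1-exp]^ (suc j) m       ≈⟨ -‿cong (sym (expm1-⋆-[1-exp]^ j m)) ⟩
    - (expm1 ⋆ [1-exp]^ j) m     ≈⟨ -‿cong (sumTo-≈0 m term) ⟩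
    - 0#                         ≈⟨ -0#≈0# ⟩
    0#                           ∎
    where
    term : ∀ t → t ≤ m → qbinom 1# m t * expm1 t * [1-exp]^ j (m ∸ t) ≈ 0#
    term zero    _   = trans (*-congʳ (zeroʳ _)) (zeroˡ _)
    term (suc t) t<m = trans (*-congˡ ([1-exp]^-< (ℕ.<-≤-trans (ℕ.∸-monoʳ-< {o = 0} (s≤s z≤n) t<m) (ℕ.≤-pred m<1+j))))
                             (zeroʳ _)

  exp*[1-exp]^≈ : ∀ j m → exp*[1-exp]^ j m ≈ [1-exp]^ j m - [1-exp]^ (suc j) m
  exp*[1-exp]^≈ j m = sym (trans (+-congˡ (-‿cong ([1-exp]^-suc j m))) (x-[x-y]≈y _ _))

  -- The generating function of stirling k is (eᶻ - 1)ᵏ / k!.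
  stirling : ℕ → Seq
  stirling k m = fromℕ (stirling2 m k)

  stirling-suc : ∀ k m → stirling (suc k) (suc m) ≈ fromℕ (suc k) * stirling (suc k) m + stirling k m
  stirling-suc k m = trans (fromℕ-+ (suc k ℕ.* stirling2 m (suc k)) _) (+-congʳ (fromℕ-* (suc k) (stirling2 m (suc k))))

  shift-expm1 : ∀ i → shift expm1 i ≈ expm1 i + δ 0 i
  shift-expm1 zero    = sym (+-identityˡ _)
  shift-expm1 (suc i) = sym (+-identityʳ _)

  expm1-⋆-stirling : ∀ k m → (expm1 ⋆ stirling k) m ≈ fromℕ (suc k) * stirling (suc k) m
  expm1-⋆-stirling k zero    = trans (*-congʳ (zeroʳ _)) (trans (zeroˡ _) (sym (zeroʳ _)))
  expm1-⋆-stirling k (suc m) = begin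
    (expm1 ⋆ stirling k) (suc m)
      ≈⟨ ⋆-leibniz₁ expm1 (stirling k) m ⟩
    (shift expm1 ⋆ stirling k) m + (expm1 ⋆ shift (stirling k)) m
      ≈⟨ +-cong (trans (⋆-congˡ (stirling k) shift-expm1 m) (⋆-distribʳ-+ expm1 (δ 0) (stirling k) m)) (shifted k) ⟩
    ((expm1 ⋆ stirling k) m + (δ 0 ⋆ stirling k) m) + fromℕ k * ((expm1 ⋆ stirling k) m + stirling k m)
      ≈⟨ +-congʳ (+-congˡ (δ0-⋆ (stirling k) m)) ⟩
    ((expm1 ⋆ stirling k) m + stirling k m) + fromℕ k * ((expm1 ⋆ stirling k) m + stirling k m)
      ≈⟨ trans (+-congʳ (sym (*-identityˡ _))) (sym (distribʳ _ _ _)) ⟩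
    fromℕ (suc k) * ((expm1 ⋆ stirling k) m + stirling k m)
      ≈⟨ *-congˡ (+-congʳ (expm1-⋆-stirling k m)) ⟩
    fromℕ (suc k) * (fromℕ (suc k) * stirling (suc k) m + stirling k m)
      ≈⟨ *-congˡ (sym (stirling-suc k m)) ⟩
    fromℕ (suc k) * stirling (suc k) (suc m) ∎
    where
    shifted : ∀ k → (expm1 ⋆ shift (stirling k)) m ≈ fromℕ k * ((expm1 ⋆ stirling k) m + stirling k m)
    shifted zero    = trans (sumTo-≈0 m (λ i _ → zeroʳ _)) (sym (zeroˡ _))
    shifted (suc k) = begin
      (expm1 ⋆ shift (stirling (suc k))) m
        ≈⟨ ⋆-congʳ expm1 (stirling-suc k) m ⟩
      (expm1 ⋆ (λ i → fromℕ (suc k) * stirling (suc k) i + stirling k i)) m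
        ≈⟨ ⋆-distribˡ-+ expm1 (λ i → fromℕ (suc k) * stirling (suc k) i) (stirling k) m ⟩
      (expm1 ⋆ (λ i → fromℕ (suc k) * stirling (suc k) i)) m + (expm1 ⋆ stirling k) m
        ≈⟨ +-cong (⋆-*ʳ _ expm1 (stirling (suc k)) m) (expm1-⋆-stirling k m) ⟩
      fromℕ (suc k) * (expm1 ⋆ stirling (suc k)) m + fromℕ (suc k) * stirling (suc k) m
        ≈⟨ sym (distribˡ _ _ _) ⟩
      fromℕ (suc k) * ((expm1 ⋆ stirling (suc k)) m + stirling (suc k) m) ∎

  stirling-zero : ∀ i → stirling 0 i ≈ δ 0 i
  stirling-zero zero    = fromℕ-1
  stirling-zero (suc i) = refl

  qBernstein≈pow*sumTo-δ : ∀ q x k l →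
                           qBernstein k l x q ≈ pow x k * sumTo l (λ m → qbinom q l m * qshift x q (l ∸ m) * δ k m)
  qBernstein≈pow*sumTo-δ q x k l with k ≤? l
  ... | yes k≤l = trans (solve 3 (λ b p s → b :* p :* s := p :* (b :* s)) refl _ _ _)
                        (*-congˡ (sym (sumTo-*δ l k _ k≤l)))
  ... | no  k≰l = sym (trans (*-congˡ (sumTo-*δ-> l k _ (ℕ.≰⇒> k≰l))) (zeroʳ _))

  module _ (char0 : CharZero) where
    open WithCharZero char0

    invSuc-inverseˡ : ∀ n → invSuc n * fromℕ (suc n) ≈ 1#
    invSuc-inverseˡ n = trans (*-comm _ _) (inverse _ (char0 n))

    fromℕ-suc-cancelˡ : ∀ n {a b} → fromℕ (suc n) * a ≈ fromℕ (suc n) * b → a ≈ b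
    fromℕ-suc-cancelˡ n {a} {b} eq = begin
      a                            ≈⟨ sym (trans (*-congʳ (invSuc-inverseˡ n)) (*-identityˡ _)) ⟩
      invSuc n * fromℕ (suc n) * a ≈⟨ *-assoc _ _ _ ⟩
      invSuc n * (fromℕ (suc n) * a) ≈⟨ *-congˡ eq ⟩
      invSuc n * (fromℕ (suc n) * b) ≈⟨ sym (*-assoc _ _ _) ⟩
      invSuc n * fromℕ (suc n) * b ≈⟨ trans (*-congʳ (invSuc-inverseˡ n)) (*-identityˡ _) ⟩
      b                            ∎

    -- bernoulli m = Σⱼ [1-exp]^ j m / (j + 1), the coefficients of Σⱼ (1 - eᶻ)ʲ / (j + 1) = z / (eᶻ - 1).
    expm1-⋆-bernoulli : ∀ n → (expm1 ⋆ bernoulli) n ≈ δ 1 n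
    expm1-⋆-bernoulli n = begin
      (expm1 ⋆ bernoulli) n
        ≈⟨ ⋆-congʳ≤ expm1 n (λ i i≤n → sumTo-extend i n (λ j → invSuc j * [1-exp]^ j i) i≤n (beyond i)) ⟩
      (expm1 ⋆ (λ m → sumTo n (λ j → invSuc j * [1-exp]^ j m))) n
        ≈⟨ ⋆-sumTo expm1 invSuc [1-exp]^ n n ⟩
      sumTo n (λ j → invSuc j * (expm1 ⋆ [1-exp]^ j) n)
        ≈⟨ sumTo-cong n (λ j → *-congˡ (expm1-⋆-[1-exp]^ j n)) ⟩
      sumTo n (λ j → invSuc j * - [1-exp]^ (suc j) n)
        ≈⟨ telescoped n ⟩
      δ 1 n ∎
      where
      beyond : ∀ i j → i < j → invSuc j * [1-exp]^ j i ≈ 0#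
      beyond i j i<j = trans (*-congˡ ([1-exp]^-< i<j)) (zeroʳ _)
      telescoped : ∀ n → sumTo n (λ j → invSuc j * - [1-exp]^ (suc j) n) ≈ δ 1 n
      telescoped zero    = trans (*-congˡ (trans (-‿cong ([1-exp]^-< {1} (s≤s z≤n))) -0#≈0#)) (zeroʳ _)
      telescoped (suc n) = begin
        sumTo (suc n) (λ j → invSuc j * - [1-exp]^ (suc j) (suc n))
          ≈⟨ sumTo-cong (suc n) difference ⟩
        sumTo (suc n) (λ j → [1-exp]^ j n - [1-exp]^ (suc j) n)
          ≈⟨ sumTo-telescope (suc n) (λ j → [1-exp]^ j n) ⟩
        [1-exp]^ 0 n - [1-exp]^ (suc (suc n)) n
          ≈⟨ +-congˡ (trans (-‿cong ([1-exp]^-< {suc (suc n)} (ℕ.m≤n⇒m≤1+n ℕ.≤-refl))) -0#≈0#) ⟩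
        [1-exp]^ 0 n + 0#
          ≈⟨ trans (+-identityʳ _) (trans (*-congʳ (trans (*-identityˡ _) fromℕ-1)) (*-identityˡ _)) ⟩
        exp^ 0 n
          ≈⟨ exp^0≈δ0 n ⟩
        δ 1 (suc n) ∎
        where
        difference : ∀ j → invSuc j * - [1-exp]^ (suc j) (suc n) ≈ [1-exp]^ j n - [1-exp]^ (suc j) n
        difference j = begin
          invSuc j * - [1-exp]^ (suc j) (suc n)
            ≈⟨ *-congˡ (trans (-‿cong (shift-[1-exp]^-suc j n)) (-‿involutive _)) ⟩
          invSuc j * (fromℕ (suc j) * exp*[1-exp]^ j n)
            ≈⟨ trans (sym (*-assoc _ _ _)) (trans (*-congʳ (invSuc-inverseˡ j)) (*-identityˡ _)) ⟩
          exp*[1-exp]^ j n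
            ≈⟨ exp*[1-exp]^≈ j n ⟩
          [1-exp]^ j n - [1-exp]^ (suc j) n ∎

    bernoulliOrd-zero : ∀ i → bernoulliOrd 0 i ≈ δ 0 i
    bernoulliOrd-zero zero    = refl
    bernoulliOrd-zero (suc i) = refl

    bernoulliOrd-suc : ∀ k m → bernoulliOrd (suc k) m ≈ (bernoulli ⋆ bernoulliOrd k) m
    bernoulliOrd-suc k m = sumTo-cong m (λ j → *-congʳ (*-congʳ (sym (qbinom-1# m j))))

    stirling-⋆-bernoulliOrd : ∀ k n → (stirling k ⋆ bernoulliOrd k) n ≈ δ k n
    stirling-⋆-bernoulliOrd zero    n = trans (⋆-cong stirling-zero bernoulliOrd-zero n) (δ0-⋆ (δ 0) n)
    stirling-⋆-bernoulliOrd (suc k) n = fromℕ-suc-cancelˡ k (begin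
      fromℕ (suc k) * (stirling (suc k) ⋆ bernoulliOrd (suc k)) n
        ≈⟨ sym (⋆-*ˡ _ (stirling (suc k)) (bernoulliOrd (suc k)) n) ⟩
      ((λ i → fromℕ (suc k) * stirling (suc k) i) ⋆ bernoulliOrd (suc k)) n
        ≈⟨ ⋆-cong (λ i → sym (expm1-⋆-stirling k i)) (bernoulliOrd-suc k) n ⟩
      ((expm1 ⋆ stirling k) ⋆ (bernoulli ⋆ bernoulliOrd k)) n
        ≈⟨ ⋆-interchange n expm1 (stirling k) bernoulli (bernoulliOrd k) ⟩
      ((expm1 ⋆ bernoulli) ⋆ (stirling k ⋆ bernoulliOrd k)) n
        ≈⟨ ⋆-cong expm1-⋆-bernoulli (stirling-⋆-bernoulliOrd k) n ⟩
      (δ 1 ⋆ δ k) n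
        ≈⟨ δ1-⋆-δ k n ⟩
      fromℕ (suc k) * δ (suc k) n ∎)

    fromℕ-!*invFact : ∀ n → fromℕ (n !) * invFact n ≈ 1#
    fromℕ-!*invFact zero    = trans (*-identityʳ _) fromℕ-1
    fromℕ-!*invFact (suc n) = begin
      fromℕ (suc n ℕ.* n !) * (invFact n * invSuc n)
        ≈⟨ *-congʳ (fromℕ-* (suc n) (n !)) ⟩
      fromℕ (suc n) * fromℕ (n !) * (invFact n * invSuc n)
        ≈⟨ solve 4 (λ s f i j → s :* f :* (i :* j) := f :* i :* (s :* j)) refl _ _ _ _ ⟩
      fromℕ (n !) * invFact n * (fromℕ (suc n) * invSuc n)
        ≈⟨ *-cong (fromℕ-!*invFact n) (inverse _ (char0 n)) ⟩
      1# * 1#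
        ≈⟨ *-identityˡ _ ⟩
      1# ∎

    invFact-binomial : ∀ {n m} → m ≤ n → invFact m * invFact (n ∸ m) ≈ qbinom 1# n m * invFact n
    invFact-binomial {n} {m} m≤n = begin
      invFact m * invFact (n ∸ m)
        ≈⟨ sym (trans (*-congˡ (fromℕ-!*invFact n)) (*-identityʳ _)) ⟩
      invFact m * invFact (n ∸ m) * (fromℕ (n !) * invFact n)
        ≈⟨ *-congˡ (*-congʳ (sym binomial-factorials)) ⟩
      invFact m * invFact (n ∸ m) * (qbinom 1# n m * fromℕ (m !) * fromℕ ((n ∸ m) !) * invFact n)
        ≈⟨ solve 6 (λ i i′ b f f′ j → i :* i′ :* (b :* f :* f′ :* j)
                                     := (f :* i) :* (f′ :* i′) :* (b :* j)) refl _ _ _ _ _ _ ⟩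
      (fromℕ (m !) * invFact m) * (fromℕ ((n ∸ m) !) * invFact (n ∸ m)) * (qbinom 1# n m * invFact n)
        ≈⟨ *-congʳ (*-cong (fromℕ-!*invFact m) (fromℕ-!*invFact (n ∸ m))) ⟩
      1# * 1# * (qbinom 1# n m * invFact n)
        ≈⟨ trans (*-congʳ (*-identityˡ _)) (*-identityˡ _) ⟩
      qbinom 1# n m * invFact n ∎
      where
      binomial-factorials : qbinom 1# n m * fromℕ (m !) * fromℕ ((n ∸ m) !) ≈ fromℕ (n !)
      binomial-factorials = begin
        qbinom 1# n m * fromℕ (m !) * fromℕ ((n ∸ m) !)
          ≈⟨ sym (*-cong (*-congˡ (qfact-1# m)) (qfact-1# (n ∸ m))) ⟩
        qbinom 1# n m * qfact 1# m * qfact 1# (n ∸ m)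
          ≈⟨ qbinom-qfact-∸ 1# m≤n ⟩
        qfact 1# n
          ≈⟨ qfact-1# n ⟩
        fromℕ (n !) ∎

    module _ (q : Carrier) where
      module Q = Convolution q

      qfactRatio : Seq
      qfactRatio m = qfact q m * invFact m

      qfactRatio-⋆ : ∀ (u v : Seq) n →
                     ((λ m → qfactRatio m * u m) Q.⋆ (λ m → qfactRatio m * v m)) n ≈ qfactRatio n * (u ⋆ v) n
      qfactRatio-⋆ u v n = trans (sumTo-cong≤ n term) (sym (*-distribˡ-sumTo n _ _))
        where
        weights : ∀ {m} → m ≤ n → qbinom q n m * qfactRatio m * qfactRatio (n ∸ m) ≈ qfactRatio n * qbinom 1# n m
        weights {m} m≤n = begin
          qbinom q n m * qfactRatio m * qfactRatio (n ∸ m)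
            ≈⟨ solve 5 (λ b f i f′ i′ → b :* (f :* i) :* (f′ :* i′) := b :* f :* f′ :* (i :* i′)) refl _ _ _ _ _ ⟩
          qbinom q n m * qfact q m * qfact q (n ∸ m) * (invFact m * invFact (n ∸ m))
            ≈⟨ *-cong (qbinom-qfact-∸ q m≤n) (invFact-binomial m≤n) ⟩
          qfact q n * (qbinom 1# n m * invFact n)
            ≈⟨ solve 3 (λ f b i → f :* (b :* i) := f :* i :* b) refl _ _ _ ⟩
          qfactRatio n * qbinom 1# n m ∎
        term : ∀ m → m ≤ n → qbinom q n m * (qfactRatio m * u m) * (qfactRatio (n ∸ m) * v (n ∸ m))
                           ≈ qfactRatio n * (qbinom 1# n m * u m * v (n ∸ m))
        term m m≤n = begin
          qbinom q n m * (qfactRatio m * u m) * (qfactRatio (n ∸ m) * v (n ∸ m))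
            ≈⟨ solve 5 (λ b r x r′ y → b :* (r :* x) :* (r′ :* y) := b :* r :* r′ :* (x :* y)) refl _ _ _ _ _ ⟩
          qbinom q n m * qfactRatio m * qfactRatio (n ∸ m) * (u m * v (n ∸ m))
            ≈⟨ *-congʳ (weights m≤n) ⟩
          qfactRatio n * qbinom 1# n m * (u m * v (n ∸ m))
            ≈⟨ solve 4 (λ r b x y → r :* b :* (x :* y) := r :* (b :* x :* y)) refl _ _ _ _ ⟩
          qfactRatio n * (qbinom 1# n m * u m * v (n ∸ m)) ∎

      qfactRatio-normalises : ∀ k (hk : ¬ (qfact q k ≈ 0#)) → fromℕ (k !) * inv (qfact q k) hk * qfactRatio k ≈ 1#
      qfactRatio-normalises k hk = begin
        fromℕ (k !) * inv (qfact q k) hk * (qfact q k * invFact k)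
          ≈⟨ solve 4 (λ f i g j → f :* i :* (g :* j) := (f :* j) :* (g :* i)) refl _ _ _ _ ⟩
        (fromℕ (k !) * invFact k) * (qfact q k * inv (qfact q k) hk)
          ≈⟨ *-cong (fromℕ-!*invFact k) (inverse _ hk) ⟩
        1# * 1#
          ≈⟨ *-identityˡ _ ⟩
        1# ∎

      qBernoulliShift≈⋆ : ∀ k x n → qBernoulliShift k n x q ≈ ((λ m → qfactRatio m * bernoulliOrd k m) Q.⋆ qshift x q) n
      qBernoulliShift≈⋆ k x n = sumTo-cong n (λ m → solve 4 (λ b r s B → b :* r :* s :* B := b :* (r :* B) :* s) refl _ _ _ _)

      stirling-qBernoulliShift-sum :
        ∀ k l x → sumTo l (λ m → qfactRatio m * fromℕ (stirling2 m k) * qBernoulliShift k (l ∸ m) x q * qbinom q l m)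
                  ≈ qfactRatio k * sumTo l (λ m → qbinom q l m * qshift x q (l ∸ m) * δ k m)
      stirling-qBernoulliShift-sum k l x = begin
        sumTo l (λ m → qfactRatio m * fromℕ (stirling2 m k) * qBernoulliShift k (l ∸ m) x q * qbinom q l m)
          ≈⟨ sumTo-cong l (λ m → trans (solve 4 (λ r s β b → r :* s :* β :* b := b :* (r :* s) :* β) refl _ _ _ _)
                                       (*-congˡ (qBernoulliShift≈⋆ k x (l ∸ m)))) ⟩
        (ratio· (stirling k) Q.⋆ (ratio· (bernoulliOrd k) Q.⋆ qshift x q)) l
          ≈⟨ sym (Q.⋆-assoc l (ratio· (stirling k)) (ratio· (bernoulliOrd k)) (qshift x q)) ⟩
        ((ratio· (stirling k) Q.⋆ ratio· (bernoulliOrd k)) Q.⋆ qshift x q) l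
          ≈⟨ Q.⋆-congˡ (qshift x q) (λ n → trans (qfactRatio-⋆ (stirling k) (bernoulliOrd k) n)
                                                 (*-congˡ (stirling-⋆-bernoulliOrd k n))) l ⟩
        (ratio· (δ k) Q.⋆ qshift x q) l
          ≈⟨ sumTo-cong l (λ m → trans (*-congʳ (*-congˡ (*-δ qfactRatio k m)))
                                       (solve 4 (λ b r d y → b :* (r :* d) :* y := r :* (b :* y :* d)) refl _ _ _ _)) ⟩
        sumTo l (λ m → qfactRatio k * (qbinom q l m * qshift x q (l ∸ m) * δ k m))
          ≈⟨ sym (*-distribˡ-sumTo l _ _) ⟩
        qfactRatio k * sumTo l (λ m → qbinom q l m * qshift x q (l ∸ m) * δ k m) ∎
        where
        ratio· : Seq → Seq
        ratio· u m = qfactRatio m * u m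

theorem10 : ∀ {c ℓ} (F : Field c ℓ) →
            let open Field F
                open FieldNotions F
            in (char0 : CharZero) →
               let open WithCharZero char0
               in (q x : Carrier) (k l : ℕ) →
                  (hk : ¬ (qfact q k ≈ 0#)) →
                  qBernstein k l x q
                    ≈ fromℕ (k !) * inv (qfact q k) hk * pow x k
                      * sumTo l (λ m → (qfact q m * invFact m)
                                       * fromℕ (stirling2 m k)
                                       * qBernoulliShift k (l ∸ m) x q
                                       * qbinom q l m)
theorem10 F char0 q x k l hk = begin
  qBernstein k l x q
    ≈⟨ qBernstein≈pow*sumTo-δ q x k l ⟩
  pow x k * Σδ
    ≈⟨ sym (trans (*-congʳ (qfactRatio-normalises char0 q k hk)) (*-identityˡ _)) ⟩
  fromℕ (k !) * inv (qfact q k) hk * qfactRatio char0 q k * (pow x k * Σδ)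
    ≈⟨ solve 4 (λ c r p s → c :* r :* (p :* s) := c :* p :* (r :* s)) refl _ _ _ _ ⟩
  fromℕ (k !) * inv (qfact q k) hk * pow x k * (qfactRatio char0 q k * Σδ)
    ≈⟨ *-congˡ (sym (stirling-qBernoulliShift-sum char0 q k l x)) ⟩
  fromℕ (k !) * inv (qfact q k) hk * pow x k
    * sumTo l (λ m → qfactRatio char0 q m * fromℕ (stirling2 m k) * qBernoulliShift k (l ∸ m) x q * qbinom q l m) ∎
  where
  open Field F
  open FieldNotions F
  open WithCharZero char0
  open QExpansion F
  open import Relation.Binary.Reasoning.Setoid setoid
  open import Algebra.Solver.Ring.NaturalCoefficients.Default commutativeSemiring using (solve; _:=_; _:*_)
  Σδ : Carrier
  Σδ = sumTo l (λ m → qbinom q l m * qshift x q (l ∸ m) * δ k m)
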